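{- For any positive integer $t$ and fixed positive integer $r$, as $n\to\infty$, $C_{2t}(n,r)=O\!\left(n^{\lceil\frac{r}{t+1}\rceil}\right)$.
   Context: An $r$-graph on vertex set $[n]$ is a family of distinct $r$-element subsets (edges) of $[n]$. For a positive integer $m$, an $r$-graph $\mathcal{H}$ is $m$-cancellative if for any $m+2$ distinct edges $A_1,\dots,A_m,B,C\in\mathcal{H}$ one has $(\cup_{i=1}^m A_i)\cup B\neq(\cup_{i=1}^m A_i)\cup C$. $C_m(n,r)$ denotes the maximum number of edges of an $m$-cancellative $r$-graph on $n$ vertices. -}

module Defs where

open import Data.Nat using (ℕ; zero; suc; _+_; _*_; _^_; _≤_; _≥_)
open import Data.Nat.DivMod using (_/_)
open import Data.Fin using (Fin; zero; suc)
open import Data.Fin.Subset using (Subset; _∪_; ⊥; ∣_∣)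
open import Data.Product using (∃; ∃-syntax; _×_; _,_)
open import Relation.Binary.PropositionalEquality using (_≡_; _≢_)
open import Function.Definitions using (Injective)

⋃F : ∀ {n m} → (Fin m → Subset n) → Subset n
⋃F {m = zero} A = ⊥
⋃F {m = suc m} A = A zero ∪ ⋃F (λ i → A (suc i))

record RGraph (r n : ℕ) : Set where
  field
    k        : ℕ
    edge     : Fin k → Subset n
    distinct : Injective _≡_ _≡_ edge
    uniform  : ∀ i → ∣ edge i ∣ ≡ r

open RGraph public

Cancellative : ∀ {r n} → ℕ → RGraph r n → Set
Cancellative m H =
  ∀ (a : Fin m → Fin (k H)) (b c : Fin (k H)) →
  Injective _≡_ _≡_ a → b ≢ c → (∀ i → a i ≢ b) → (∀ i → a i ≢ c) →
  ⋃F (λ i → edge H (a i)) ∪ edge H b ≢ ⋃F (λ i → edge H (a i)) ∪ edge H c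

ceilDivSuc : ℕ → ℕ → ℕ
ceilDivSuc r t = (r + t) / suc t

module Submission where

-- Pad every edge (of size r ≤ (t+1)s) to (t+1)s slots and cut it into t+1
-- blocks of s slots; a block is a code in Fin ((n+1)^s), and every edge is
-- the union of the vertex sets of its t+1 codes.  Key observation: in a
-- 2t-cancellative graph with at least 2t+2 edges, every nonempty set G of
-- edges contains an edge one of whose blocks is a block of at most two edges
-- of G.  Otherwise take B ∈ G, an edge C ≠ B sharing a block with B, and for
-- each of the t remaining blocks of B and of C a further edge having that
-- block: these 2t edges A satisfy A ∪ B = A ∪ C.  Peeling off such edges one
-- at a time decreases the potential Σ_S min(2, #{edges of G with block S}),
-- which is at most 2(n+1)^s, so there are at most 2(n+1)^s edges.

open import Defs
open import Data.Nat using (ℕ; zero; suc; _+_; _*_; _^_; _∸_; _⊓_; _≤_; _<_; _≥_; z≤n; s≤s)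
open import Data.Nat.Properties hiding (suc-injective)
open import Data.Nat.DivMod using (_%_; m≡m%n+[m/n]*n; m%n<n)
open import Data.Fin using (Fin; zero; suc; _↑ˡ_; _↑ʳ_; splitAt; combine; punchIn; punchOut; cast; funToFin; finToFun)
  renaming (_≟_ to _≟ᶠ_)
open import Data.Fin.Properties using (any?; suc-injective; punchIn-punchOut; cast-involutive; combine-surjective; finToFun-funToFin)
open import Data.Fin.Subset using (Subset; _∪_; _∩_; ∁; _-_; ⊤; ∣_∣; _∈_; _∉_; _⊆_; ⁅_⁆; Nonempty; inside; outside)
open import Data.Fin.Subset.Properties
  using (_∈?_; nonempty?; ∉⊥; ∣⊤∣≡n; Empty-unique; ∣⊥∣≡0; ∣⁅x⁆∣≡1; x∈⁅x⁆; x∈⁅y⁆⇒x≡y; ⊆-antisym; p⊆q⇒∣p∣≤∣q∣;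
         p⊂q⇒∣p∣<∣q∣; x∈p∩q⁺; x∈p∩q⁻; x∈p∪q⁺; x∈p∪q⁻; x∈∁p⇒x∉p; x∉p⇒x∈∁p; ∣∁p∣≡n∸∣p∣; p─⊥≡p; p─q⊆p;
         x∈p⇒∣p-x∣<∣p∣; drop-∷-⊆; s⊆s; out⊆)
open import Data.Vec using ([]; _∷_; here; there; tabulate)
open import Data.Vec.Properties using (lookup∘tabulate; []=⇒lookup; lookup⇒[]=)
open import Data.Vec.Functional using (_++_)
open import Data.Vec.Functional.Properties using (lookup-++ˡ; lookup-++ʳ)
open import Data.Vec.Functional.Relation.Unary.All.Properties using (++⁺)
open import Data.Bool.Properties using (T-≡)
open import Data.Product using (∃; ∃-syntax; _×_; _,_; proj₁; proj₂)
open import Data.Sum using (_⊎_; inj₁; inj₂; [_,_])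
open import Data.Empty using () renaming (⊥ to Empty; ⊥-elim to ⊥-elim)
open import Function using (_∘_; Equivalence)
open import Function.Definitions using (Injective)
open import Relation.Nullary using (Dec; yes; no; contradiction)
open import Relation.Nullary.Decidable using (isYes; toWitness; fromWitness; decidable-stable; _×-dec_; ¬?)
open import Relation.Unary using (Decidable)
open import Relation.Binary.PropositionalEquality using (_≡_; _≢_; refl; sym; trans; cong; cong₂; subst; module ≡-Reasoning)

∣p∪q∣≤∣p∣+∣q∣ : ∀ {n} (p q : Subset n) → ∣ p ∪ q ∣ ≤ ∣ p ∣ + ∣ q ∣
∣p∪q∣≤∣p∣+∣q∣ []           []           = z≤n
∣p∪q∣≤∣p∣+∣q∣ (inside ∷ p)  (inside ∷ q)  = s≤s (≤-trans (∣p∪q∣≤∣p∣+∣q∣ p q) (+-monoʳ-≤ ∣ p ∣ (n≤1+n _)))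
∣p∪q∣≤∣p∣+∣q∣ (inside ∷ p)  (outside ∷ q) = s≤s (∣p∪q∣≤∣p∣+∣q∣ p q)
∣p∪q∣≤∣p∣+∣q∣ (outside ∷ p) (inside ∷ q)  = ≤-trans (s≤s (∣p∪q∣≤∣p∣+∣q∣ p q)) (≤-reflexive (sym (+-suc ∣ p ∣ ∣ q ∣)))
∣p∪q∣≤∣p∣+∣q∣ (outside ∷ p) (outside ∷ q) = ∣p∪q∣≤∣p∣+∣q∣ p q

∣p∣≤1+∣p-x∣ : ∀ {n} (p : Subset n) (x : Fin n) → ∣ p ∣ ≤ suc ∣ p - x ∣
∣p∣≤1+∣p-x∣ (inside ∷ p)  zero    = s≤s (≤-reflexive (cong ∣_∣ (sym (p─⊥≡p p))))
∣p∣≤1+∣p-x∣ (outside ∷ p) zero    = ≤-trans (≤-reflexive (cong ∣_∣ (sym (p─⊥≡p p)))) (n≤1+n _)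
∣p∣≤1+∣p-x∣ (inside ∷ p)  (suc x) = s≤s (∣p∣≤1+∣p-x∣ p x)
∣p∣≤1+∣p-x∣ (outside ∷ p) (suc x) = ∣p∣≤1+∣p-x∣ p x

x∉p-x : ∀ {n} (p : Subset n) (x : Fin n) → x ∉ p - x
x∉p-x (_ ∷ p) zero    ()
x∉p-x (_ ∷ p) (suc x) (there x∈p-x) = x∉p-x p x x∈p-x

outsideElement : ∀ {n} (X Z : Subset n) → ∣ Z ∣ < ∣ X ∣ → ∃ λ x → x ∈ X × x ∉ Z
outsideElement X Z ∣Z∣<∣X∣ with any? (λ x → (x ∈? X) ×-dec ¬? (x ∈? Z))
... | yes found = found
... | no none    = contradiction (p⊆q⇒∣p∣≤∣q∣ X⊆Z) (<⇒≱ ∣Z∣<∣X∣)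
  where
  X⊆Z : X ⊆ Z
  X⊆Z {x} x∈X = decidable-stable (x ∈? Z) (λ x∉Z → none (x , x∈X , x∉Z))

∈⋃F⁺ : ∀ {n m} (A : Fin m → Subset n) (i : Fin m) {x} → x ∈ A i → x ∈ ⋃F A
∈⋃F⁺ A zero    x∈A = x∈p∪q⁺ (inj₁ x∈A)
∈⋃F⁺ A (suc i) x∈A = x∈p∪q⁺ (inj₂ (∈⋃F⁺ (A ∘ suc) i x∈A))

∈⋃F⁻ : ∀ {n m} (A : Fin m → Subset n) {x} → x ∈ ⋃F A → ∃ λ i → x ∈ A i
∈⋃F⁻ {m = zero}  A x∈⊥ = contradiction x∈⊥ ∉⊥
∈⋃F⁻ {m = suc m} A x∈⋃ with x∈p∪q⁻ (A zero) (⋃F (A ∘ suc)) x∈⋃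
... | inj₁ x∈A₀ = zero , x∈A₀
... | inj₂ x∈⋃' with ∈⋃F⁻ (A ∘ suc) x∈⋃'
...   | i , x∈Aᵢ = suc i , x∈Aᵢ

image : ∀ {K m} → (Fin m → Fin K) → Subset K
image γ = ⋃F (λ j → ⁅ γ j ⁆)

∣image∣≤ : ∀ {K m} (γ : Fin m → Fin K) → ∣ image γ ∣ ≤ m
∣image∣≤ {K} {zero}  γ = ≤-reflexive (∣⊥∣≡0 K)
∣image∣≤ {m = suc m} γ = begin
  ∣ ⁅ γ zero ⁆ ∪ image (γ ∘ suc) ∣    ≤⟨ ∣p∪q∣≤∣p∣+∣q∣ ⁅ γ zero ⁆ (image (γ ∘ suc)) ⟩
  ∣ ⁅ γ zero ⁆ ∣ + ∣ image (γ ∘ suc) ∣ ≤⟨ +-mono-≤ (≤-reflexive (∣⁅x⁆∣≡1 (γ zero))) (∣image∣≤ (γ ∘ suc)) ⟩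
  suc m                               ∎
  where open ≤-Reasoning

image⁻ : ∀ {K m} (γ : Fin m → Fin K) {x} → x ∈ image γ → ∃ λ j → γ j ≡ x
image⁻ γ x∈ with ∈⋃F⁻ (λ j → ⁅ γ j ⁆) x∈
... | j , x∈⁅γj⁆ = j , sym (x∈⁅y⁆⇒x≡y (γ j) x∈⁅γj⁆)

image⁺ : ∀ {K m} (γ : Fin m → Fin K) j → γ j ∈ image γ
image⁺ γ j = ∈⋃F⁺ (λ j → ⁅ γ j ⁆) j (x∈⁅x⁆ (γ j))

⟪_⟫ : ∀ {K} {P : Fin K → Set} → Decidable P → Subset K
⟪ P? ⟫ = tabulate (λ i → isYes (P? i))

∈⟪⟫⁺ : ∀ {K} {P : Fin K → Set} (P? : Decidable P) {i} → P i → i ∈ ⟪ P? ⟫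
∈⟪⟫⁺ P? {i} Pi = lookup⇒[]= i _
  (trans (lookup∘tabulate (λ i → isYes (P? i)) i) (Equivalence.to T-≡ (fromWitness {a? = P? i} Pi)))

∈⟪⟫⁻ : ∀ {K} {P : Fin K → Set} (P? : Decidable P) {i} → i ∈ ⟪ P? ⟫ → P i
∈⟪⟫⁻ P? {i} i∈ = toWitness {a? = P? i}
  (Equivalence.from T-≡ (trans (sym (lookup∘tabulate (λ i → isYes (P? i)) i)) ([]=⇒lookup i∈)))

record Listing {K} (Z : Subset K) (m : ℕ) : Set where
  field
    elem      : Fin m → Fin K
    injective : Injective _≡_ _≡_ elem
    sound     : ∀ j → elem j ∈ Z
    complete  : ∀ {x} → x ∈ Z → ∃ λ j → elem j ≡ x

listing : ∀ {K} (Z : Subset K) → Listing Z ∣ Z ∣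
listing [] = record { elem = λ (); injective = λ { {()} }; sound = λ (); complete = λ () }
listing (outside ∷ Z) = record
  { elem      = suc ∘ elem
  ; injective = injective ∘ suc-injective
  ; sound     = there ∘ sound
  ; complete  = λ { (there x∈Z) → let (j , eq) = complete x∈Z in j , cong suc eq }
  }
  where open Listing (listing Z)
listing (inside ∷ Z) = record { elem = elem′ ; injective = injective′ ; sound = sound′ ; complete = complete′ }
  where
  open Listing (listing Z)
  elem′ : Fin (suc ∣ Z ∣) → Fin (suc _)
  elem′ zero    = zero
  elem′ (suc j) = suc (elem j)
  injective′ : Injective _≡_ _≡_ elem′
  injective′ {zero}  {zero}  _  = refl
  injective′ {suc i} {suc j} eq = cong suc (injective (suc-injective eq))
  sound′ : ∀ j → elem′ j ∈ inside ∷ Z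
  sound′ zero    = here
  sound′ (suc j) = there (sound j)
  complete′ : ∀ {x} → x ∈ inside ∷ Z → ∃ λ j → elem′ j ≡ x
  complete′ here          = zero , refl
  complete′ (there x∈Z) = let (j , eq) = complete x∈Z in suc j , cong suc eq

exactListing : ∀ {K} (Z : Subset K) {m} → ∣ Z ∣ ≡ m → Listing Z m
exactListing Z refl = listing Z

record Between {K} (X Y : Subset K) (m : ℕ) : Set where
  field
    set   : Subset K
    lower : X ⊆ set
    upper : set ⊆ Y
    size  : ∣ set ∣ ≡ m

sandwich : ∀ {K} (X Y : Subset K) m → X ⊆ Y → ∣ X ∣ ≤ m → m ≤ ∣ Y ∣ → Between X Y m
sandwich [] [] m _ _ m≤0 = record { set = [] ; lower = λ () ; upper = λ () ; size = sym (n≤0⇒n≡0 m≤0) }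
sandwich (inside ∷ X) (outside ∷ Y) m X⊆Y _ _ with X⊆Y here
... | ()
sandwich (inside ∷ X) (inside ∷ Y) (suc m) X⊆Y (s≤s X≤m) (s≤s m≤Y) =
  take (sandwich X Y m (drop-∷-⊆ X⊆Y) X≤m m≤Y)
  where
  take : Between X Y m → Between (inside ∷ X) (inside ∷ Y) (suc m)
  take Z = record { set = inside ∷ set ; lower = s⊆s lower ; upper = s⊆s upper ; size = cong suc size }
    where open Between Z
sandwich (outside ∷ X) (outside ∷ Y) m X⊆Y X≤m m≤Y =
  skip (sandwich X Y m (drop-∷-⊆ X⊆Y) X≤m m≤Y)
  where
  skip : Between X Y m → Between (outside ∷ X) (outside ∷ Y) m
  skip Z = record { set = outside ∷ set ; lower = s⊆s lower ; upper = s⊆s upper ; size = size }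
    where open Between Z
-- A free element of Y is skipped if the rest of Y still has room for m, else taken.
sandwich (outside ∷ X) (inside ∷ Y) m X⊆Y X≤m m≤1+Y with m ≤? ∣ Y ∣
... | yes m≤Y = skip (sandwich X Y m (drop-∷-⊆ X⊆Y) X≤m m≤Y)
  where
  skip : Between X Y m → Between (outside ∷ X) (inside ∷ Y) m
  skip Z = record { set = outside ∷ set ; lower = s⊆s lower ; upper = out⊆ upper ; size = size }
    where open Between Z
... | no m≰Y = take m m≤1+Y (≰⇒> m≰Y)
  where
  take : ∀ m → m ≤ suc ∣ Y ∣ → ∣ Y ∣ < m → Between (outside ∷ X) (inside ∷ Y) m
  take (suc m) (s≤s m≤Y) (s≤s Y≤m) = record
    { set = inside ∷ set ; lower = out⊆ lower ; upper = s⊆s upper ; size = cong suc size }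
    where open Between (sandwich X Y m (drop-∷-⊆ X⊆Y) (≤-trans (p⊆q⇒∣p∣≤∣q∣ (drop-∷-⊆ X⊆Y)) Y≤m) m≤Y)

∑ : ∀ {M} → (Fin M → ℕ) → ℕ
∑ {zero}  f = 0
∑ {suc M} f = f zero + ∑ (f ∘ suc)

∑-mono : ∀ {M} {f g : Fin M → ℕ} → (∀ S → f S ≤ g S) → ∑ f ≤ ∑ g
∑-mono {zero}  f≤g = z≤n
∑-mono {suc M} f≤g = +-mono-≤ (f≤g zero) (∑-mono (f≤g ∘ suc))

∑-mono-< : ∀ {M} {f g : Fin M → ℕ} → (∀ S → f S ≤ g S) → ∀ S₀ → f S₀ < g S₀ → ∑ f < ∑ g
∑-mono-< f≤g zero      f<g = +-mono-<-≤ f<g (∑-mono (f≤g ∘ suc))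
∑-mono-< f≤g (suc S₀) f<g = +-mono-≤-< (f≤g zero) (∑-mono-< (f≤g ∘ suc) S₀ f<g)

∑-bound : ∀ {M} {f : Fin M → ℕ} d → (∀ S → f S ≤ d) → ∑ f ≤ M * d
∑-bound {zero}  d f≤d = z≤n
∑-bound {suc M} d f≤d = +-mono-≤ (f≤d zero) (∑-bound d (f≤d ∘ suc))

-- Elements i of Fin K carry codes S of Fin M (the relation R).  If
-- every nonempty G ⊆ Fin K has an element carrying a code carried by at most
-- d elements of G, then K ≤ M·d.  The potential Σ_S min(d, #{i ∈ G : R i S})
-- is at most M·d and drops when such an element is deleted from G.
module Peeling {K M : ℕ} {R : Fin K → Fin M → Set} (R? : ∀ i S → Dec (R i S)) where

  holders : Fin M → Subset K
  holders S = ⟪ (λ i → R? i S) ⟫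

  RareCode : ℕ → Subset K → Set
  RareCode d G = ∃ λ i → i ∈ G × ∃ λ S → R i S × ∣ G ∩ holders S ∣ ≤ d

  potential : ℕ → Subset K → ℕ
  potential d G = ∑ (λ S → d ⊓ ∣ G ∩ holders S ∣)

  -- Deleting an element carrying a code held by at most d elements of G
  -- lowers that code's term and no other.
  potential-drop : ∀ d {G i S} → i ∈ G → R i S → ∣ G ∩ holders S ∣ ≤ d →
                   potential d (G - i) < potential d G
  potential-drop d {G} {i} {S₀} i∈G RiS₀ few = ∑-mono-< (λ S → ⊓-monoʳ-≤ d (∣shrinks∣ S)) S₀ drop
    where
    G-i⊆G = p─q⊆p G ⁅ i ⁆
    shrinks : ∀ S → (G - i) ∩ holders S ⊆ G ∩ holders S
    shrinks S x∈ = let (x∈G-i , x∈h) = x∈p∩q⁻ (G - i) (holders S) x∈ in x∈p∩q⁺ (G-i⊆G x∈G-i , x∈h)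
    ∣shrinks∣ : ∀ S → ∣ (G - i) ∩ holders S ∣ ≤ ∣ G ∩ holders S ∣
    ∣shrinks∣ S = p⊆q⇒∣p∣≤∣q∣ (shrinks S)
    drop : d ⊓ ∣ (G - i) ∩ holders S₀ ∣ < d ⊓ ∣ G ∩ holders S₀ ∣
    drop = begin-strict
      d ⊓ ∣ (G - i) ∩ holders S₀ ∣ ≤⟨ m⊓n≤n d _ ⟩
      ∣ (G - i) ∩ holders S₀ ∣     <⟨ p⊂q⇒∣p∣<∣q∣ (shrinks S₀ , i , x∈p∩q⁺ (i∈G , ∈⟪⟫⁺ _ RiS₀) ,
                                                     x∉p-x G i ∘ proj₁ ∘ x∈p∩q⁻ (G - i) (holders S₀)) ⟩
      ∣ G ∩ holders S₀ ∣           ≡⟨ sym (m≥n⇒m⊓n≡n few) ⟩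
      d ⊓ ∣ G ∩ holders S₀ ∣       ∎
      where open ≤-Reasoning

  size≤potential : ∀ d → (∀ G → Nonempty G → RareCode d G) → ∀ bound G → ∣ G ∣ ≤ bound → ∣ G ∣ ≤ potential d G
  size≤potential d rare zero G ∣G∣≤0 = ≤-trans ∣G∣≤0 z≤n
  size≤potential d rare (suc bound) G ∣G∣≤1+b with nonempty? G
  ... | no G-empty = ≤-trans (≤-reflexive (trans (cong ∣_∣ (Empty-unique G-empty)) (∣⊥∣≡0 K))) z≤n
  ... | yes G-nonempty with rare G G-nonempty
  ...   | i , i∈G , S , RiS , few = begin
    ∣ G ∣                     ≤⟨ ∣p∣≤1+∣p-x∣ G i ⟩
    suc ∣ G - i ∣             ≤⟨ s≤s (size≤potential d rare bound (G - i) ∣G-i∣≤b) ⟩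
    suc (potential d (G - i)) ≤⟨ potential-drop d i∈G RiS few ⟩
    potential d G             ∎
    where
    open ≤-Reasoning
    ∣G-i∣≤b : ∣ G - i ∣ ≤ bound
    ∣G-i∣≤b = ≤-pred (≤-trans (x∈p⇒∣p-x∣<∣p∣ i∈G) ∣G∣≤1+b)

  peeling : ∀ d → (∀ G → Nonempty G → RareCode d G) → K ≤ M * d
  peeling d rare = begin
    K              ≡⟨ sym (∣⊤∣≡n K) ⟩
    ∣ ⊤ {K} ∣      ≤⟨ size≤potential d rare K ⊤ (≤-reflexive (∣⊤∣≡n K)) ⟩
    potential d ⊤  ≤⟨ ∑-bound {M} d (λ S → m⊓n≤m d ∣ ⊤ ∩ holders S ∣) ⟩
    M * d          ∎
    where open ≤-Reasoning

Covered : ∀ {r n l} (H : RGraph r n) → Fin (k H) → Fin (k H) → (Fin l → Fin (k H)) → Set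
Covered H B C γ = ∀ {x} → x ∈ edge H B → x ∈ edge H C ⊎ ∃ λ j → x ∈ edge H (γ j)

-- In an m-cancellative graph with at least m + 2 edges, no two distinct edges
-- B, C cover each other with the help of at most m further edges γ j.  (Pad
-- the family γ injectively to exactly m edges A avoiding B, C; then
-- A ∪ B = A ∪ C.)
cancellationObstruction : ∀ {r n m l} (H : RGraph r n) → Cancellative m H → 2 + m ≤ k H →
  (B C : Fin (k H)) (γ : Fin l → Fin (k H)) → l ≤ m → B ≢ C → (∀ j → γ j ∉ ⁅ B ⁆ ∪ ⁅ C ⁆) →
  Covered H B C γ → Covered H C B γ → Empty
cancellationObstruction {m = m} H canc 2+m≤K B C γ l≤m B≢C γ-avoids covB covC =
  canc a B C injective B≢C (λ j → a-avoids j ∘ inB) (λ j → a-avoids j ∘ inC)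
       (⊆-antisym (absorb covB) (absorb covC))
  where
  K = k H
  BC = ⁅ B ⁆ ∪ ⁅ C ⁆
  inB : ∀ {x} → x ≡ B → x ∈ BC
  inB refl = x∈p∪q⁺ (inj₁ (x∈⁅x⁆ B))
  inC : ∀ {x} → x ≡ C → x ∈ BC
  inC refl = x∈p∪q⁺ (inj₂ (x∈⁅x⁆ C))

  image⊆∁BC : image γ ⊆ ∁ BC
  image⊆∁BC x∈ = let (j , γj≡x) = image⁻ γ x∈ in x∉p⇒x∈∁p (subst (_∉ BC) γj≡x (γ-avoids j))
  m≤∣∁BC∣ : m ≤ ∣ ∁ BC ∣
  m≤∣∁BC∣ = begin
    m                           ≡⟨ sym (m+n∸m≡n 2 m) ⟩
    2 + m ∸ 2                   ≤⟨ ∸-monoˡ-≤ 2 2+m≤K ⟩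
    K ∸ 2                       ≡⟨ cong (K ∸_) (sym (cong₂ _+_ (∣⁅x⁆∣≡1 B) (∣⁅x⁆∣≡1 C))) ⟩
    K ∸ (∣ ⁅ B ⁆ ∣ + ∣ ⁅ C ⁆ ∣) ≤⟨ ∸-monoʳ-≤ K (∣p∪q∣≤∣p∣+∣q∣ ⁅ B ⁆ ⁅ C ⁆) ⟩
    K ∸ ∣ BC ∣                  ≡⟨ sym (∣∁p∣≡n∸∣p∣ BC) ⟩
    ∣ ∁ BC ∣                    ∎
    where open ≤-Reasoning
  padding : Between (image γ) (∁ BC) m
  padding = sandwich (image γ) (∁ BC) m image⊆∁BC (≤-trans (∣image∣≤ γ) l≤m) m≤∣∁BC∣
  open Between padding using (set; lower; upper; size)
  open Listing (exactListing set size) renaming (elem to a)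

  a-avoids : ∀ j → a j ∉ BC
  a-avoids j = x∈∁p⇒x∉p (upper (sound j))

  U : Subset _
  U = ⋃F (λ j → edge H (a j))
  γ⊆U : ∀ j {x} → x ∈ edge H (γ j) → x ∈ U
  γ⊆U j x∈γj with complete (lower (image⁺ γ j))
  ... | j′ , aj′≡γj = ∈⋃F⁺ (λ j → edge H (a j)) j′ (subst (λ D → _ ∈ edge H D) (sym aj′≡γj) x∈γj)
  absorb : ∀ {D E} → Covered H D E γ → U ∪ edge H D ⊆ U ∪ edge H E
  absorb cov x∈ with x∈p∪q⁻ U _ x∈
  ... | inj₁ x∈U = x∈p∪q⁺ (inj₁ x∈U)
  ... | inj₂ x∈D with cov x∈D
  ...   | inj₁ x∈E        = x∈p∪q⁺ (inj₂ x∈E)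
  ...   | inj₂ (j , x∈γj) = x∈p∪q⁺ (inj₁ (γ⊆U j x∈γj))

record BlockDecomposition {r n} (H : RGraph r n) (b M : ℕ) : Set₁ where
  field
    _occursIn_ : Fin n → Fin M → Set
    block      : Fin (k H) → Fin b → Fin M
    sound      : ∀ {i j x} → x occursIn block i j → x ∈ edge H i
    complete   : ∀ {i x} → x ∈ edge H i → ∃ λ j → x occursIn block i j

module RareBlocks {t r n M} (H : RGraph r n) (canc : Cancellative (2 * t) H) (2+2t≤K : 2 + 2 * t ≤ k H)
                  (D : BlockDecomposition H (suc t) M) where

  open BlockDecomposition D
  K = k H

  HasBlock : Fin K → Fin M → Set
  HasBlock i S = ∃ λ j → block i j ≡ S

  hasBlock? : ∀ i S → Dec (HasBlock i S)
  hasBlock? i S = any? (λ j → block i j ≟ᶠ S)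

  open Peeling hasBlock? public using (holders; RareCode; peeling)

  viaBlock : ∀ {i S x} → HasBlock i S → x occursIn S → x ∈ edge H i
  viaBlock (j , refl) = sound

  configuration : (B C : Fin K) → B ≢ C → (j₀ : Fin (suc t)) → block C j₀ ≡ block B zero →
    (α β : Fin t → Fin K) → (∀ j → HasBlock (α j) (block B (suc j))) →
    (∀ j → HasBlock (β j) (block C (punchIn j₀ j))) →
    (∀ j → (α ++ β) j ∉ ⁅ B ⁆ ∪ ⁅ C ⁆) → Empty
  configuration B C B≢C j₀ shared α β α-has β-has avoids =
    cancellationObstruction H canc 2+2t≤K B C (α ++ β) t+t≤2t B≢C avoids coverB coverC
    where
    t+t≤2t : t + t ≤ 2 * t
    t+t≤2t = ≤-reflexive (cong (t +_) (sym (+-identityʳ t)))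
    coverB : Covered H B C (α ++ β)
    coverB x∈B with complete x∈B
    ... | zero  , occ = inj₁ (viaBlock (j₀ , shared) occ)
    ... | suc j , occ = inj₂ (j ↑ˡ t , subst (λ E → _ ∈ edge H E) (sym (lookup-++ˡ α β j)) (viaBlock (α-has j) occ))
    coverC : Covered H C B (α ++ β)
    coverC {x} x∈C with complete x∈C
    ... | j , occ with j₀ ≟ᶠ j
    ...   | yes refl = inj₁ (viaBlock (zero , sym shared) occ)
    ...   | no j₀≢j  = inj₂ (t ↑ʳ punchOut j₀≢j , subst (λ E → x ∈ edge H E) (sym (lookup-++ʳ α β _))
                         (viaBlock (β-has (punchOut j₀≢j))
                           (subst (λ j → x occursIn block C j) (sym (punchIn-punchOut j₀≢j)) occ)))

  sharer : ∀ G S (Z : Subset K) → ∣ Z ∣ ≤ 2 → 3 ≤ ∣ G ∩ holders S ∣ → ∃ λ E → E ∈ G × HasBlock E S × E ∉ Z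
  sharer G S Z ∣Z∣≤2 three with outsideElement (G ∩ holders S) Z (≤-trans (s≤s ∣Z∣≤2) three)
  ... | E , E∈ , E∉Z = let (E∈G , E∈h) = x∈p∩q⁻ G (holders S) E∈ in E , E∈G , ∈⟪⟫⁻ _ E∈h , E∉Z

  notUbiquitous : ∀ G → (∀ {i} → i ∈ G → ∀ j → 3 ≤ ∣ G ∩ holders (block i j) ∣) → ∀ {B} → B ∈ G → Empty
  notUbiquitous G ubiq {B} B∈G
    with sharer G (block B zero) ⁅ B ⁆ (≤-trans (≤-reflexive (∣⁅x⁆∣≡1 B)) (n≤1+n 1)) (ubiq B∈G zero)
  ... | C , C∈G , (j₀ , shared) , C∉B =
    configuration B C (λ B≡C → C∉B (subst (_∈ ⁅ B ⁆) B≡C (x∈⁅x⁆ B))) j₀ shared α β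
      (proj₁ ∘ proj₂ ∘ proj₂ ∘ αs) (proj₁ ∘ proj₂ ∘ proj₂ ∘ βs)
      (++⁺ (_∉ BC) (proj₂ ∘ proj₂ ∘ proj₂ ∘ αs) (proj₂ ∘ proj₂ ∘ proj₂ ∘ βs))
    where
    BC = ⁅ B ⁆ ∪ ⁅ C ⁆
    ∣BC∣≤2 : ∣ BC ∣ ≤ 2
    ∣BC∣≤2 = ≤-trans (∣p∪q∣≤∣p∣+∣q∣ ⁅ B ⁆ ⁅ C ⁆) (≤-reflexive (cong₂ _+_ (∣⁅x⁆∣≡1 B) (∣⁅x⁆∣≡1 C)))
    αs : ∀ j → ∃ λ E → E ∈ G × HasBlock E (block B (suc j)) × E ∉ BC
    αs j = sharer G _ BC ∣BC∣≤2 (ubiq B∈G (suc j))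
    βs : ∀ j → ∃ λ E → E ∈ G × HasBlock E (block C (punchIn j₀ j)) × E ∉ BC
    βs j = sharer G _ BC ∣BC∣≤2 (ubiq C∈G (punchIn j₀ j))
    α β : Fin t → Fin K
    α = proj₁ ∘ αs
    β = proj₁ ∘ βs

  rareBlock : ∀ G → Nonempty G → RareCode 2 G
  rareBlock G (B , B∈G) with any? (λ i → (i ∈? G) ×-dec any? (λ j → ∣ G ∩ holders (block i j) ∣ ≤? 2))
  ... | yes (i , i∈G , j , few) = i , i∈G , block i j , (j , refl) , few
  ... | no none = ⊥-elim (notUbiquitous G (λ i∈G j → ≰⇒> (λ few → none (_ , i∈G , j , few))) B∈G)

  edgeBound : K ≤ M * 2
  edgeBound = peeling 2 rareBlock

-- A set of at most m vertices written into m slots, each holding a vertex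
-- (suc x) or nothing (zero): its listing padded by empty slots.
slots : ∀ {n m} (E : Subset n) → ∣ E ∣ ≤ m → Fin m → Fin (suc n)
slots E ∣E∣≤m = ((suc ∘ elem) ++ (λ _ → zero)) ∘ cast (sym (m+[n∸m]≡n ∣E∣≤m))
  where open Listing (listing E)

slots-sound : ∀ {n m} (E : Subset n) (∣E∣≤m : ∣ E ∣ ≤ m) p {x} → slots E ∣E∣≤m p ≡ suc x → x ∈ E
slots-sound E ∣E∣≤m p = filled (splitAt ∣ E ∣ (cast (sym (m+[n∸m]≡n ∣E∣≤m)) p))
  where
  open Listing (listing E)
  filled : ∀ {d x} (v : Fin ∣ E ∣ ⊎ Fin d) → [ suc ∘ elem , (λ _ → zero) ] v ≡ suc x → x ∈ E
  filled (inj₁ j) eq = subst (_∈ E) (suc-injective eq) (sound j)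
  filled (inj₂ _) ()

slots-complete : ∀ {n m} (E : Subset n) (∣E∣≤m : ∣ E ∣ ≤ m) {x} → x ∈ E → ∃ λ p → slots E ∣E∣≤m p ≡ suc x
slots-complete {m = m} E ∣E∣≤m x∈E with Listing.complete (listing E) x∈E
... | j , refl = cast eq (j ↑ˡ (m ∸ ∣ E ∣)) , (begin
  padded (cast (sym eq) (cast eq (j ↑ˡ (m ∸ ∣ E ∣)))) ≡⟨ cong padded (cast-involutive (sym eq) eq _) ⟩
  padded (j ↑ˡ (m ∸ ∣ E ∣))                          ≡⟨ lookup-++ˡ (suc ∘ elem) _ j ⟩
  suc (elem j)                                       ∎)
  where
  open Listing (listing E)
  open ≡-Reasoning
  eq = m+[n∸m]≡n ∣E∣≤m
  padded = (suc ∘ elem) ++ (λ _ → zero)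

-- An r-graph with r ≤ b·s has a decomposition into b blocks with codes in
-- Fin ((n+1)^s): block j of an edge is the j-th run of s slots of its encoding.
slotBlocks : ∀ {r n} (H : RGraph r n) b s → r ≤ b * s → BlockDecomposition H b (suc n ^ s)
slotBlocks {n = n} H b s r≤bs = record
  { _occursIn_ = λ x c → ∃ λ l → finToFun c l ≡ suc x
  ; block      = λ i j → funToFin (run i j)
  ; sound      = λ { {i} {j} (l , eq) → slots-sound (edge H i) (fits i) _ (trans (sym (finToFun-funToFin (run i j) l)) eq) }
  ; complete   = complete
  }
  where
  fits : ∀ i → ∣ edge H i ∣ ≤ b * s
  fits i = subst (_≤ b * s) (sym (uniform H i)) r≤bs
  run : Fin (k H) → Fin b → Fin s → Fin (suc n)
  run i j l = slots (edge H i) (fits i) (combine j l)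
  complete : ∀ {i x} → x ∈ edge H i → ∃ λ j → ∃ λ l → finToFun (funToFin (run i j)) l ≡ suc x
  complete {i} x∈ with slots-complete (edge H i) (fits i) x∈
  ... | p , slot≡x with combine-surjective {b} {s} p
  ...   | j , l , refl = j , l , trans (finToFun-funToFin (run i j) l) slot≡x

cancellativeBound : ∀ t s {r n} (H : RGraph r n) → Cancellative (2 * t) H → r ≤ suc t * s →
                    k H ≤ suc (2 * t) + 2 * suc n ^ s
cancellativeBound t s {n = n} H canc r≤[t+1]s with k H ≤? suc (2 * t)
... | yes few  = ≤-trans few (m≤m+n _ _)
... | no many = ≤-trans (≤-trans edgeBound (≤-reflexive (*-comm (suc n ^ s) 2))) (m≤n+m _ (suc (2 * t)))
  where open RareBlocks H canc (≰⇒> many) (slotBlocks H (suc t) s r≤[t+1]s)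

r≤[t+1]⌈r/[t+1]⌉ : ∀ r t → r ≤ suc t * ceilDivSuc r t
r≤[t+1]⌈r/[t+1]⌉ r t = +-cancelʳ-≤ t r (suc t * q) (begin
  r + t                       ≡⟨ m≡m%n+[m/n]*n (r + t) (suc t) ⟩
  (r + t) % suc t + q * suc t ≤⟨ +-monoˡ-≤ (q * suc t) (≤-pred (m%n<n (r + t) (suc t))) ⟩
  t + q * suc t               ≡⟨ +-comm t (q * suc t) ⟩
  q * suc t + t               ≡⟨ cong (_+ t) (*-comm q (suc t)) ⟩
  suc t * q + t               ∎)
  where
  open ≤-Reasoning
  q = ceilDivSuc r t

[1+n]^s≤2^s*n^s : ∀ {n} s → 1 ≤ n → suc n ^ s ≤ 2 ^ s * n ^ s
[1+n]^s≤2^s*n^s zero    _   = ≤-refl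
[1+n]^s≤2^s*n^s {n} (suc s) 1≤n = begin
  suc n * suc n ^ s           ≤⟨ *-mono-≤ 1+n≤2n ([1+n]^s≤2^s*n^s s 1≤n) ⟩
  (2 * n) * (2 ^ s * n ^ s)   ≡⟨ [m*n]*[o*p]≡[m*o]*[n*p] 2 n (2 ^ s) (n ^ s) ⟩
  (2 * 2 ^ s) * (n * n ^ s)   ∎
  where
  open ≤-Reasoning
  1+n≤2n : suc n ≤ 2 * n
  1+n≤2n = ≤-trans (+-monoˡ-≤ n 1≤n) (≤-reflexive (cong (n +_) (sym (+-identityʳ n))))

polynomialBound : ∀ a s {n} → 1 ≤ n → a + 2 * suc n ^ s ≤ (a + 2 * 2 ^ s) * n ^ s
polynomialBound a s {n@(suc _)} 1≤n = begin
  a + 2 * suc n ^ s               ≤⟨ +-mono-≤ (m≤m*n a (n ^ s) {{m^n≢0 n s}}) (*-monoʳ-≤ 2 ([1+n]^s≤2^s*n^s s 1≤n)) ⟩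
  a * n ^ s + 2 * (2 ^ s * n ^ s) ≡⟨ cong (a * n ^ s +_) (sym (*-assoc 2 (2 ^ s) (n ^ s))) ⟩
  a * n ^ s + 2 * 2 ^ s * n ^ s   ≡⟨ sym (*-distribʳ-+ (n ^ s) a (2 * 2 ^ s)) ⟩
  (a + 2 * 2 ^ s) * n ^ s         ∎
  where open ≤-Reasoning

-- C_{2t}(n, r) ≤ (2t + 1 + 2·2^s) n^s for all n ≥ 1, where s = ⌈r/(t+1)⌉.
lemma8 : ∀ (t r : ℕ) → t ≥ 1 → r ≥ 1 →
    ∃[ c ] ∃[ N ] ∀ (n : ℕ) → n ≥ N → (H : RGraph r n) → Cancellative (2 * t) H →
      k H ≤ c * n ^ ceilDivSuc r t
lemma8 t r _ _ = suc (2 * t) + 2 * 2 ^ s , 1 , λ n 1≤n H canc → begin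
  k H                               ≤⟨ cancellativeBound t s H canc (r≤[t+1]⌈r/[t+1]⌉ r t) ⟩
  suc (2 * t) + 2 * suc n ^ s       ≤⟨ polynomialBound (suc (2 * t)) s 1≤n ⟩
  (suc (2 * t) + 2 * 2 ^ s) * n ^ s ∎
  where
  open ≤-Reasoning
  s = ceilDivSuc r t
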